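{- Let $H=(U,(A_1,\dots,A_m))$ be a harmonic set system and suppose there exist $i<j$ with $A_i=A_j$. Then $A_1=A_2=\dots=A_m$, or $(m,i,j)=(3,1,3)$.
   Context: A set system is $H=(U,(A_1,\dots,A_m))$ with $A_i\subseteq U$. For $I\subseteq[m]$, $H_I=\bigcap_{i\in I}A_i$ ($=U$ if $I=\varnothing$). The run decomposition of a finite set $I$ of positive integers is the partition formed by the sizes, sorted nonincreasingly, of the maximal runs of consecutive integers in $I$. $H$ is harmonic if $|H_I|=|H_J|$ whenever $I,J\subseteq[m]$ have the same run decomposition. -}

module Defs where

open import Data.Nat using (ℕ; zero; suc; _≤ᵇ_)
open import Data.Bool using (Bool; true; false; if_then_else_)
open import Data.Fin using (Fin)
open import Data.Fin.Subset using (Subset; ⋂; ∣_∣; _∈_; inside; outside)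
open import Data.Fin.Subset.Properties using (_∈?_)
open import Data.List using (List; []; _∷_; filter; map)
open import Data.List.Base using (allFin)
open import Data.Vec using (Vec; toList)
open import Relation.Binary.PropositionalEquality using (_≡_)

-- A set system on a finite ground set U = Fin n with m sets,
-- indexed by Fin m (index k : Fin m stands for A_{k+1}).
record SetSystem (n m : ℕ) : Set where
  constructor setSystem
  field
    A : Fin m → Subset n

open SetSystem public

-- H_I = ⋂_{i ∈ I} A_i  (= U when I = ∅, since ⋂ [] = ⊤)
H[_] : ∀ {n m} → SetSystem n m → Subset m → Subset n
H[ H ] I = ⋂ (map (A H) (filter (_∈? I) (allFin _)))

-- lengths of maximal runs of consecutive elements (in increasing order)
-- of a subset given as its characteristic vector; the accumulator is the
-- length of the current run
runsAux : ℕ → List Bool → List ℕ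
runsAux zero    []            = []
runsAux (suc k) []            = suc k ∷ []
runsAux k       (true ∷ bs)   = runsAux (suc k) bs
runsAux zero    (false ∷ bs)  = runsAux zero bs
runsAux (suc k) (false ∷ bs)  = suc k ∷ runsAux zero bs

insertDesc : ℕ → List ℕ → List ℕ
insertDesc x []       = x ∷ []
insertDesc x (y ∷ ys) = if y ≤ᵇ x then x ∷ y ∷ ys else y ∷ insertDesc x ys

sortDesc : List ℕ → List ℕ
sortDesc []       = []
sortDesc (x ∷ xs) = insertDesc x (sortDesc xs)

runDecomposition : ∀ {m} → Subset m → List ℕ
runDecomposition I = sortDesc (runsAux zero (Data.List.map isIn (toList I)))
  where
  isIn : _ → Bool
  isIn inside  = true
  isIn outside = false

Harmonic : ∀ {n m} → SetSystem n m → Set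
Harmonic {n} {m} H = (I J : Subset m) → runDecomposition I ≡ runDecomposition J →
                     ∣ H[ H ] I ∣ ≡ ∣ H[ H ] J ∣

{-# OPTIONS --safe #-}

-- All singletons have run decomposition (1), so all the A_k have the same size. A pair
-- {k, l} has run decomposition (2) or (1,1) according as l = k + 1 or l > k + 1, and
-- H_{k,l} = A_k ∩ A_l. From A_i = A_j we get |A_i ∩ A_j| = |A_i|, hence every pair {k, l}
-- of the same kind as {i, j} has |A_k ∩ A_l| = |A_k| = |A_l|, i.e. A_k = A_l. Adjacent
-- pairs connect all indices; pairs at distance ≥ 2 connect them as soon as m ≥ 4
-- (via 2 ~ 4 ~ 1 ~ l for l ≥ 3), and for m ≤ 3 the only such pair is {1, 3} with m = 3.

module Submission where

open import Defs
open import Data.Nat using (ℕ; _<_)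
open import Data.Fin using (Fin; toℕ)
open import Data.Product using (_×_)
open import Data.Sum using (_⊎_)
open import Relation.Binary.PropositionalEquality using (_≡_)

open import Level using (Level)
open import Data.Nat using (suc; _+_; _≤_; z≤n; s≤s)
open import Data.Nat.Properties using (suc-injective; n≮n; ≤-refl; ≤-trans; m≤n⇒m<n∨m≡n)
open import Data.Fin using (zero; suc)
open import Data.Fin.Properties using (toℕ<n)
open import Data.Fin.Subset using (Subset; _∈_; _⊆_; _∩_; _∪_; ⁅_⁆; ⊥; ⋂; ∣_∣; inside; outside)
open import Data.Fin.Subset.Properties
  using (_∈?_; drop-∷-⊆; p⊆q⇒∣p∣≤∣q∣; ⊆-antisym; ∈⊤; x∈⁅x⁆; x∈⁅y⁆⇒x≡y;
         x∈p∩q⁺; x∈p∩q⁻; x∈p∪q⁻; p⊆p∪q; q⊆p∪q; p∩q⊆p; p∩q⊆q; ∩-idem; ∪-identityˡ)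
open import Data.List using (List; []; _∷_; allFin)
open import Data.List.Relation.Unary.All as All using (All; []; _∷_)
import Data.List.Relation.Unary.All.Properties as All
open import Data.List.Membership.Propositional.Properties using (∈-filter⁺; ∈-filter⁻; ∈-allFin)
open import Data.Vec using ([]; _∷_; here)
open import Data.Product using (_,_; proj₂)
open import Data.Sum using (inj₁; inj₂; [_,_]′)
open import Relation.Binary.PropositionalEquality using (refl; sym; trans; cong; subst; module ≡-Reasoning)
open import Relation.Nullary using (contradiction)

private
  variable
    a : Level
    X : Set a
    m n : ℕ

p⊆q⇒∣p∣≡∣q∣⇒p≡q : {p q : Subset n} → p ⊆ q → ∣ p ∣ ≡ ∣ q ∣ → p ≡ q
p⊆q⇒∣p∣≡∣q∣⇒p≡q {p = []}          {[]}          _   _ = refl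
p⊆q⇒∣p∣≡∣q∣⇒p≡q {p = inside  ∷ p} {inside  ∷ q} p⊆q e =
  cong (inside ∷_) (p⊆q⇒∣p∣≡∣q∣⇒p≡q (drop-∷-⊆ p⊆q) (suc-injective e))
p⊆q⇒∣p∣≡∣q∣⇒p≡q {p = outside ∷ p} {outside ∷ q} p⊆q e =
  cong (outside ∷_) (p⊆q⇒∣p∣≡∣q∣⇒p≡q (drop-∷-⊆ p⊆q) e)
p⊆q⇒∣p∣≡∣q∣⇒p≡q {p = inside  ∷ p} {outside ∷ q} p⊆q _ = contradiction (p⊆q here) λ ()
p⊆q⇒∣p∣≡∣q∣⇒p≡q {p = outside ∷ p} {inside  ∷ q} p⊆q e =
  contradiction (subst (_≤ ∣ q ∣) e (p⊆q⇒∣p∣≤∣q∣ (drop-∷-⊆ p⊆q))) (n≮n _)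

x∈⋂⁺ : {x : Fin n} {ps : List (Subset n)} → All (x ∈_) ps → x ∈ ⋂ ps
x∈⋂⁺ []             = ∈⊤
x∈⋂⁺ (x∈p ∷ x∈⋂ps) = x∈p∩q⁺ (x∈p , x∈⋂⁺ x∈⋂ps)

x∈⋂⁻ : {x : Fin n} (ps : List (Subset n)) → x ∈ ⋂ ps → All (x ∈_) ps
x∈⋂⁻ []       _      = []
x∈⋂⁻ (p ∷ ps) x∈⋂p∷ps with x∈p∩q⁻ p (⋂ ps) x∈⋂p∷ps
... | x∈p , x∈⋂ps = x∈p ∷ x∈⋂⁻ ps x∈⋂ps

module _ (H : SetSystem n m) where

  x∈H[I]⁺ : ∀ {I x} → (∀ {k} → k ∈ I → x ∈ A H k) → x ∈ H[ H ] I
  x∈H[I]⁺ {I} x∈A =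
    x∈⋂⁺ (All.map⁺ (All.tabulate λ k∈ → x∈A (proj₂ (∈-filter⁻ (_∈? I) {xs = allFin m} k∈))))

  x∈H[I]⁻ : ∀ {I x} → x ∈ H[ H ] I → ∀ {k} → k ∈ I → x ∈ A H k
  x∈H[I]⁻ {I} x∈H k∈I = All.lookup (All.map⁻ (x∈⋂⁻ _ x∈H)) (∈-filter⁺ (_∈? I) (∈-allFin _) k∈I)

  H[⁅k⁆]≡A : ∀ k → H[ H ] ⁅ k ⁆ ≡ A H k
  H[⁅k⁆]≡A k = ⊆-antisym (λ x∈H → x∈H[I]⁻ x∈H (x∈⁅x⁆ k))
    (λ {x} x∈A → x∈H[I]⁺ λ k′∈ → subst (λ k′ → x ∈ A H k′) (sym (x∈⁅y⁆⇒x≡y k k′∈)) x∈A)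

  H[I∪J]≡H[I]∩H[J] : ∀ I J → H[ H ] (I ∪ J) ≡ H[ H ] I ∩ H[ H ] J
  H[I∪J]≡H[I]∩H[J] I J = ⊆-antisym
    (λ x∈H → x∈p∩q⁺ ( x∈H[I]⁺ (λ k∈I → x∈H[I]⁻ x∈H (p⊆p∪q J k∈I))
                    , x∈H[I]⁺ (λ k∈J → x∈H[I]⁻ x∈H (q⊆p∪q I J k∈J))))
    (λ x∈H∩H → let x∈HI , x∈HJ = x∈p∩q⁻ _ _ x∈H∩H in
      x∈H[I]⁺ λ k∈ → [ x∈H[I]⁻ x∈HI , x∈H[I]⁻ x∈HJ ]′ (x∈p∪q⁻ I J k∈))

  H[⁅k⁆∪⁅l⁆]≡Aₖ∩Aₗ : ∀ k l → H[ H ] (⁅ k ⁆ ∪ ⁅ l ⁆) ≡ A H k ∩ A H l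
  H[⁅k⁆∪⁅l⁆]≡Aₖ∩Aₗ k l
    rewrite H[I∪J]≡H[I]∩H[J] ⁅ k ⁆ ⁅ l ⁆ | H[⁅k⁆]≡A k | H[⁅k⁆]≡A l = refl

Adjacent Distant : Fin m → Fin m → Set
Adjacent k l = suc (toℕ k) ≡ toℕ l
Distant  k l = suc (toℕ k) < toℕ l

runDecomposition-⊥ : ∀ m → runDecomposition (⊥ {m}) ≡ []
runDecomposition-⊥ 0       = refl
runDecomposition-⊥ (suc m) = runDecomposition-⊥ m

runDecomposition-⁅⁆ : (k : Fin m) → runDecomposition ⁅ k ⁆ ≡ 1 ∷ []
runDecomposition-⁅⁆ {1}           zero    = refl
runDecomposition-⁅⁆ {suc (suc m)} zero    = cong (insertDesc 1) (runDecomposition-⊥ m)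
-- A leading outside is skipped by runsAux zero, so runDecomposition (outside ∷ p)
-- reduces to runDecomposition p; this and the later suc-clauses rely on that.
runDecomposition-⁅⁆               (suc k) = runDecomposition-⁅⁆ k

runDecomposition-adjacent : (k l : Fin m) → Adjacent k l →
                            runDecomposition (⁅ k ⁆ ∪ ⁅ l ⁆) ≡ 2 ∷ []
runDecomposition-adjacent {suc (suc m)} zero (suc zero) _ = begin
    runDecomposition (inside ∷ inside ∷ ⊥ {m} ∪ ⊥)
      ≡⟨ cong (λ p → runDecomposition (inside ∷ inside ∷ p)) (∪-identityˡ (⊥ {m})) ⟩
    runDecomposition (inside ∷ inside ∷ ⊥ {m})
      ≡⟨ runDecomposition-inside∷inside∷⊥ m ⟩
    2 ∷ [] ∎
  where
  open ≡-Reasoning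
  runDecomposition-inside∷inside∷⊥ : ∀ m → runDecomposition (inside ∷ inside ∷ ⊥ {m}) ≡ 2 ∷ []
  runDecomposition-inside∷inside∷⊥ 0       = refl
  runDecomposition-inside∷inside∷⊥ (suc m) = cong (insertDesc 2) (runDecomposition-⊥ m)
runDecomposition-adjacent (suc k) (suc l) k+1≡l = runDecomposition-adjacent k l (suc-injective k+1≡l)

runDecomposition-distant : (k l : Fin m) → Distant k l →
                           runDecomposition (⁅ k ⁆ ∪ ⁅ l ⁆) ≡ 1 ∷ 1 ∷ []
runDecomposition-distant zero (suc (suc l)) _ = begin
    runDecomposition (inside ∷ outside ∷ ⊥ ∪ ⁅ l ⁆)
      ≡⟨ cong (λ p → runDecomposition (inside ∷ outside ∷ p)) (∪-identityˡ ⁅ l ⁆) ⟩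
    runDecomposition (inside ∷ outside ∷ ⁅ l ⁆)
      ≡⟨ cong (insertDesc 1) (runDecomposition-⁅⁆ l) ⟩
    1 ∷ 1 ∷ [] ∎
  where open ≡-Reasoning
runDecomposition-distant zero (suc zero) (s≤s ())
runDecomposition-distant (suc k) (suc l) (s≤s k+1<l) = runDecomposition-distant k l k+1<l

Constant : {X : Set a} → (Fin m → X) → Set a
Constant f = ∀ k l → f k ≡ f l

adjacent-equal⇒constant : (f : Fin m → X) → (∀ k l → Adjacent k l → f k ≡ f l) → Constant f
adjacent-equal⇒constant {m = suc m} f f-adj k l = trans (f≡f₀ f f-adj k) (sym (f≡f₀ f f-adj l))
  where
  f≡f₀ : ∀ {m} (f : Fin (suc m) → X) → (∀ k l → Adjacent k l → f k ≡ f l) → ∀ k → f k ≡ f zero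
  f≡f₀ f f-adj zero    = refl
  f≡f₀ {m = suc _} f f-adj (suc k) =
    trans (f≡f₀ (λ k → f (suc k)) (λ k l k+1≡l → f-adj (suc k) (suc l) (cong suc k+1≡l)) k)
          (sym (f-adj zero (suc zero) refl))

distant-equal⇒constant : (f : Fin (4 + m) → X) → (∀ k l → Distant k l → f k ≡ f l) → Constant f
distant-equal⇒constant f f-dist k l = trans (f≡f₀ k) (sym (f≡f₀ l))
  where
  f≡f₀ : ∀ k → f k ≡ f zero
  f≡f₀ zero          = refl
  f≡f₀ (suc zero)    = trans (f-dist (suc zero) (suc (suc (suc zero))) ≤-refl)
                             (sym (f-dist zero (suc (suc (suc zero))) (s≤s (s≤s z≤n))))
  f≡f₀ (suc (suc k)) = sym (f-dist zero (suc (suc k)) (s≤s (s≤s z≤n)))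

Distant⇒3+i≤m : (i j : Fin m) → Distant i j → 3 + toℕ i ≤ m
Distant⇒3+i≤m i j i+1<j = ≤-trans (s≤s i+1<j) (toℕ<n j)

distant-equal⇒constant⊎Fin3 : (f : Fin m → X) (i j : Fin m) → Distant i j →
  (∀ k l → Distant k l → f k ≡ f l) → Constant f ⊎ (m ≡ 3 × toℕ i ≡ 0 × toℕ j ≡ 2)
distant-equal⇒constant⊎Fin3 {m = suc (suc (suc (suc _)))} f _ _ _ f-dist =
  inj₁ (distant-equal⇒constant f f-dist)
distant-equal⇒constant⊎Fin3 {m = 3} _ zero (suc (suc zero)) _ _ = inj₂ (refl , refl , refl)
distant-equal⇒constant⊎Fin3 {m = 3} _ zero (suc zero) (s≤s ()) _
distant-equal⇒constant⊎Fin3 {m = 3} _ i@(suc _) j i+1<j _ =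
  contradiction (Distant⇒3+i≤m i j i+1<j) λ { (s≤s (s≤s (s≤s ()))) }
distant-equal⇒constant⊎Fin3 {m = 2} _ i j i+1<j _ =
  contradiction (Distant⇒3+i≤m i j i+1<j) λ { (s≤s (s≤s ())) }
distant-equal⇒constant⊎Fin3 {m = 1} _ i j i+1<j _ =
  contradiction (Distant⇒3+i≤m i j i+1<j) λ { (s≤s ()) }

module _ {H : SetSystem n m} (harmonic : Harmonic H) where
  open ≡-Reasoning

  harmonic-∣A∣ : ∀ k l → ∣ A H k ∣ ≡ ∣ A H l ∣
  harmonic-∣A∣ k l = begin
    ∣ A H k ∣        ≡⟨ cong ∣_∣ (H[⁅k⁆]≡A H k) ⟨
    ∣ H[ H ] ⁅ k ⁆ ∣ ≡⟨ harmonic _ _ (trans (runDecomposition-⁅⁆ k) (sym (runDecomposition-⁅⁆ l))) ⟩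
    ∣ H[ H ] ⁅ l ⁆ ∣ ≡⟨ cong ∣_∣ (H[⁅k⁆]≡A H l) ⟩
    ∣ A H l ∣        ∎

  harmonic-pair : ∀ {i j k l r} → A H i ≡ A H j → runDecomposition (⁅ i ⁆ ∪ ⁅ j ⁆) ≡ r →
                  runDecomposition (⁅ k ⁆ ∪ ⁅ l ⁆) ≡ r → A H k ≡ A H l
  harmonic-pair {i} {j} {k} {l} Aᵢ≡Aⱼ runsᵢⱼ runsₖₗ = begin
      A H k         ≡⟨ p⊆q⇒∣p∣≡∣q∣⇒p≡q (p∩q⊆p _ _) (trans ∣Aₖ∩Aₗ∣≡∣Aᵢ∣ (harmonic-∣A∣ i k)) ⟨
      A H k ∩ A H l ≡⟨ p⊆q⇒∣p∣≡∣q∣⇒p≡q (p∩q⊆q _ _) (trans ∣Aₖ∩Aₗ∣≡∣Aᵢ∣ (harmonic-∣A∣ i l)) ⟩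
      A H l         ∎
    where
    ∣Aₖ∩Aₗ∣≡∣Aᵢ∣ : ∣ A H k ∩ A H l ∣ ≡ ∣ A H i ∣
    ∣Aₖ∩Aₗ∣≡∣Aᵢ∣ = begin
      ∣ A H k ∩ A H l ∣          ≡⟨ cong ∣_∣ (H[⁅k⁆∪⁅l⁆]≡Aₖ∩Aₗ H k l) ⟨
      ∣ H[ H ] (⁅ k ⁆ ∪ ⁅ l ⁆) ∣ ≡⟨ harmonic _ _ (trans runsₖₗ (sym runsᵢⱼ)) ⟩
      ∣ H[ H ] (⁅ i ⁆ ∪ ⁅ j ⁆) ∣ ≡⟨ cong ∣_∣ (H[⁅k⁆∪⁅l⁆]≡Aₖ∩Aₗ H i j) ⟩
      ∣ A H i ∩ A H j ∣          ≡⟨ cong (λ Aⱼ → ∣ A H i ∩ Aⱼ ∣) Aᵢ≡Aⱼ ⟨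
      ∣ A H i ∩ A H i ∣          ≡⟨ cong ∣_∣ (∩-idem (A H i)) ⟩
      ∣ A H i ∣                  ∎

proposition5p1 : ∀ {n m} (H : SetSystem n m) → Harmonic H →
    (i j : Fin m) → toℕ i < toℕ j → A H i ≡ A H j →
    ((k l : Fin m) → A H k ≡ A H l) ⊎ (m ≡ 3 × toℕ i ≡ 0 × toℕ j ≡ 2)
proposition5p1 H harmonic i j i<j Aᵢ≡Aⱼ with m≤n⇒m<n∨m≡n i<j
... | inj₂ i+1≡j = inj₁ (adjacent-equal⇒constant (A H) λ k l k+1≡l →
  harmonic-pair harmonic Aᵢ≡Aⱼ (runDecomposition-adjacent i j i+1≡j) (runDecomposition-adjacent k l k+1≡l))
... | inj₁ i+1<j = distant-equal⇒constant⊎Fin3 (A H) i j i+1<j λ k l k+1<l →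
  harmonic-pair harmonic Aᵢ≡Aⱼ (runDecomposition-distant i j i+1<j) (runDecomposition-distant k l k+1<l)
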